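{- Let $q$ be a prime power and $n$ an odd positive integer with $\gcd(n,q)=1$. The multiplier $\mu_{ -q}$ gives a splitting of $n$ over $\mathbb{F}_{q^2}$ if and only if for every prime $r$ dividing $n$, either $\mathrm{ord}_r(q)$ is odd or $\mathrm{ord}_r(q^2)$ is even.
   Context: $\mathrm{ord}_r(q)$ is the smallest positive integer $t$ with $q^t\equiv1\pmod r$. The $q^2$-cyclotomic coset of $s$ modulo $n$ is $\{s(q^2)^j\bmod n:j\ge0\}$. For $\gcd(b,n)=1$, $\mu_b$ gives a splitting of $n$ over $\mathbb{F}_{q^2}$ if there are sets $S_1,S_2$, each a union of $q^2$-cyclotomic cosets modulo $n$, with $S_1\cup S_2=\{1,\dots,n-1\}$, $S_1\cap S_2=\emptyset$, $bS_1\equiv S_2$ and $bS_2\equiv S_1\pmod n$. -}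

module Defs where

open import Level using (Level; suc; zero)
open import Data.Nat using (ℕ; _+_; _*_; _∸_; _^_; _≤_; _<_; NonZero)
open import Data.Nat.DivMod using (_%_)
open import Data.Nat.Primality using (Prime)
open import Data.Product using (Σ; ∃; _×_)
open import Data.Sum using (_⊎_)
open import Data.Empty using (⊥)
open import Relation.Nullary using (¬_)
open import Relation.Binary.PropositionalEquality using (_≡_)
open import Function.Bundles using (_⇔_)

IsPrimePower : ℕ → Set
IsPrimePower q = Σ ℕ λ p → Σ ℕ λ k → Prime p × 1 ≤ k × q ≡ p ^ k

Odd : ℕ → Set
Odd t = t % 2 ≡ 1

Even : ℕ → Set
Even t = t % 2 ≡ 0

IsOrd : (r : ℕ) .{{_ : NonZero r}} → ℕ → ℕ → Set
IsOrd r a t = (0 < t) × (a ^ t % r ≡ 1 % r) × (∀ s → 0 < s → s < t → ¬ (a ^ s % r ≡ 1 % r))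

Subset : Set₁
Subset = ℕ → Set

InCoset : (n : ℕ) .{{_ : NonZero n}} → ℕ → ℕ → ℕ → Set
InCoset n q s t = ∃ λ j → t ≡ (s * (q ^ 2) ^ j) % n

UnionOfCosets : (n : ℕ) .{{_ : NonZero n}} → ℕ → Subset → Set₁
UnionOfCosets n q S = Σ (ℕ → Set) λ I →
  ((s : ℕ) → I s → s < n) ×
  (∀ t → S t ⇔ (∃ λ s → I s × InCoset n q s t))

_·_mod_ : ℕ → Subset → (n : ℕ) .{{_ : NonZero n}} → Subset
(b · S mod n) t = ∃ λ s → S s × t ≡ (b * s) % n

_≐_ : Subset → Subset → Set
A ≐ B = ∀ t → A t ⇔ B t

GivesSplitting : (n : ℕ) .{{_ : NonZero n}} → (q b : ℕ) → Set₁
GivesSplitting n q b = Σ Subset λ S₁ → Σ Subset λ S₂ →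
  UnionOfCosets n q S₁ × UnionOfCosets n q S₂ ×
  (∀ t → (S₁ t ⊎ S₂ t) ⇔ (1 ≤ t × t < n)) ×
  (∀ t → S₁ t → S₂ t → ⊥) ×
  ((b · S₁ mod n) ≐ S₂) × ((b · S₂ mod n) ≐ S₁)

-- the residue of -q modulo n, represented as (n-1)·q mod n
negMod : (n : ℕ) .{{_ : NonZero n}} → ℕ → ℕ
negMod n q = ((n ∸ 1) * q) % n

module Submission where

-- Since b = -q satisfies b² ≡ q² (mod n), the multiplier μ_b maps every q²-cyclotomic coset C
-- to a coset bC with b(bC) = C.  Hence μ_b gives a splitting iff it fixes no coset of a
-- nonzero residue: a fixed coset fits in neither S₁ nor S₂, and if there is none one may put C
-- into S₁ exactly when min C < min bC.  The coset of t is fixed iff t ≡ -q·t·q^(2l) (mod n),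
-- i.e. n ∣ t (q^e + 1) for an odd e.  For an odd prime r, r ∣ q^e + 1 with e odd happens iff
-- ord_r(q) is even and ord_r(q²) = ord_r(q)/2 is odd.  So a prime r ∣ n violating the order
-- condition makes the coset of n/r fixed, and a fixed coset of 0 < t < n yields a prime
-- r ∣ gcd(n, q^e + 1) violating it.

open import Defs
open import Data.Empty using (⊥-elim)
open import Data.Fin using (toℕ; fromℕ<)
open import Data.Fin.Properties using (pigeonhole; toℕ-fromℕ<)
open import Data.List using ([]; _∷_)
open import Data.List.Relation.Unary.All using (_∷_)
open import Data.Nat
open import Data.Nat.Coprimality using (Coprime; coprime?; coprime-divisor; gcd≡1⇒coprime)
open import Data.Nat.Divisibility
open import Data.Nat.DivMod
open import Data.Nat.GCD using (gcd; gcd[m,n]∣m; gcd[m,n]∣n)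
open import Data.Nat.Induction using (<-wellFounded)
open import Data.Nat.ListAction using (product)
open import Data.Nat.Primality
  using (Prime; prime[2]; prime⇒irreducible; prime⇒nonZero; prime⇒nonTrivial; euclidsLemma)
open import Data.Nat.Primality.Factorisation using (factorise)
open import Data.Nat.Properties
open import Data.Nat.Tactic.RingSolver using (solve-∀)
open import Data.Product using (∃; _×_; _,_; proj₁; proj₂)
open import Data.Sum using (_⊎_; inj₁; inj₂; [_,_])
open import Function using (_∘_)
open import Function.Bundles using (_⇔_; mk⇔; Equivalence)
open import Induction.WellFounded using (Acc; acc)
open import Relation.Binary.Definitions using (tri<; tri≈; tri>)
open import Relation.Binary.PropositionalEquality hiding ([_])
open import Relation.Nullary using (¬_; Dec; yes; no)
open import Relation.Unary using (Decidable)

open Equivalence using (to; from)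

module Congruence (n : ℕ) .{{_ : NonZero n}} where

  infix 4 _≈_
  _≈_ : ℕ → ℕ → Set
  a ≈ b = a % n ≡ b % n

  ≡⇒≈ : ∀ {a b} → a ≡ b → a ≈ b
  ≡⇒≈ = cong (_% n)

  %-≈ : ∀ a → a % n ≈ a
  %-≈ a = m%n%n≡m%n a n

  +-cong : ∀ {a a′ b b′} → a ≈ a′ → b ≈ b′ → a + b ≈ a′ + b′
  +-cong {a} {a′} {b} {b′} p q = begin
    (a + b) % n             ≡⟨ %-distribˡ-+ a b n ⟩
    (a % n + b % n) % n     ≡⟨ cong₂ (λ u v → (u + v) % n) p q ⟩
    (a′ % n + b′ % n) % n   ≡⟨ %-distribˡ-+ a′ b′ n ⟨
    (a′ + b′) % n           ∎
    where open ≡-Reasoning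

  *-cong : ∀ {a a′ b b′} → a ≈ a′ → b ≈ b′ → a * b ≈ a′ * b′
  *-cong {a} {a′} {b} {b′} p q = begin
    (a * b) % n             ≡⟨ %-distribˡ-* a b n ⟩
    (a % n * (b % n)) % n   ≡⟨ cong₂ (λ u v → (u * v) % n) p q ⟩
    (a′ % n * (b′ % n)) % n ≡⟨ %-distribˡ-* a′ b′ n ⟨
    (a′ * b′) % n           ∎
    where open ≡-Reasoning

  ^-cong : ∀ {a b} k → a ≈ b → a ^ k ≈ b ^ k
  ^-cong zero    p = refl
  ^-cong (suc k) p = *-cong p (^-cong k p)

  ∣⇒≈0 : ∀ {a} → n ∣ a → a ≈ 0
  ∣⇒≈0 {a} n∣a = trans (n∣m⇒m%n≡0 a n n∣a) (sym (m*n%n≡0 0 n))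

  ≈0⇒∣ : ∀ {a} → a ≈ 0 → n ∣ a
  ≈0⇒∣ {a} p = m%n≡0⇒n∣m a n (trans p (m*n%n≡0 0 n))

  ≈⇒∣∸ : ∀ {a b} → a ≈ b → b ≤ a → n ∣ a ∸ b
  ≈⇒∣∸ {a} {b} p b≤a = divides (a / n ∸ b / n) (begin
    a ∸ b                                     ≡⟨ cong₂ _∸_ (m≡m%n+[m/n]*n a n) (m≡m%n+[m/n]*n b n) ⟩
    (a % n + a / n * n) ∸ (b % n + b / n * n) ≡⟨ cong (λ u → (u + a / n * n) ∸ (b % n + b / n * n)) p ⟩
    (b % n + a / n * n) ∸ (b % n + b / n * n) ≡⟨ [m+n]∸[m+o]≡n∸o (b % n) _ _ ⟩
    a / n * n ∸ b / n * n                     ≡⟨ *-distribʳ-∸ n (a / n) (b / n) ⟨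
    (a / n ∸ b / n) * n                       ∎)
    where open ≡-Reasoning

  ∣∸⇒≈ : ∀ {a b} → n ∣ a ∸ b → b ≤ a → a ≈ b
  ∣∸⇒≈ {a} {b} n∣a∸b b≤a = trans (cong (_% n) (sym (m+[n∸m]≡n b≤a))) (%-remove-+ʳ b n∣a∸b)

  in-range⇒≉0 : ∀ {s} → 1 ≤ s → s < n → ¬ s ≈ 0
  in-range⇒≉0 1≤s s<n s≈0 = <⇒≢ 1≤s (sym (trans (sym (m<n⇒m%n≡m s<n)) (trans s≈0 (m*n%n≡0 0 n))))

  ≉0⇒residue-in-range : ∀ {a} → ¬ a ≈ 0 → 1 ≤ a % n × a % n < n
  ≉0⇒residue-in-range {a} a≉0 =
    n≢0⇒n>0 (λ a%n≡0 → a≉0 (trans a%n≡0 (sym (m*n%n≡0 0 n)))) , m%n<n a n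

  ≉0-*-unit : ∀ {a y z} → ¬ a ≈ 0 → y * z ≈ 1 → ¬ a * y ≈ 0
  ≉0-*-unit {a} {y} {z} a≉0 yz≈1 ay≈0 = a≉0 (begin
    a % n             ≡⟨ ≡⇒≈ (sym (*-identityʳ a)) ⟩
    (a * 1) % n       ≡⟨ *-cong {a} refl (sym yz≈1) ⟩
    (a * (y * z)) % n ≡⟨ ≡⇒≈ (sym (*-assoc a y z)) ⟩
    (a * y * z) % n   ≡⟨ *-cong {a * y} {0} {z} ay≈0 refl ⟩
    0 % n             ∎)
    where open ≡-Reasoning

  +-negate : ∀ c → c + (n ∸ 1) * c ≡ c * n
  +-negate c = begin
    c + (n ∸ 1) * c ≡⟨ +-comm c _ ⟩
    (n ∸ 1) * c + c ≡⟨ cong ((n ∸ 1) * c +_) (*-identityˡ c) ⟨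
    (n ∸ 1) * c + 1 * c ≡⟨ *-distribʳ-+ c (n ∸ 1) 1 ⟨
    (n ∸ 1 + 1) * c ≡⟨ cong (_* c) (m∸n+n≡m (>-nonZero⁻¹ n)) ⟩
    n * c ≡⟨ *-comm n c ⟩
    c * n ∎
    where open ≡-Reasoning

  +-cancelʳ : ∀ {a b} c → a + c ≈ b + c → a ≈ b
  +-cancelʳ {a} {b} c p = trans (sym (undo a)) (trans (+-cong p refl) (undo b))
    where
    undo : ∀ a → a + c + (n ∸ 1) * c ≈ a
    undo a = trans (cong (_% n) (trans (+-assoc a c _) (cong (a +_) (+-negate c))))
                   ([m+kn]%n≡m%n a c n)

  sum≈0-unique : ∀ {a b c} → a + c ≈ 0 → b + c ≈ 0 → a ≈ b
  sum≈0-unique {c = c} p q = +-cancelʳ c (trans p (sym q))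

  sum≈0⇒square≈square : ∀ {a c} → a + c ≈ 0 → a * a ≈ c * c
  sum≈0⇒square≈square {a} {c} p = sum≈0-unique {c = a * c} a[a+c] c[c+a]
    where
    a[a+c] : a * a + a * c ≈ 0
    a[a+c] = trans (≡⇒≈ (sym (*-distribˡ-+ a a c)))
                   (trans (*-cong {a} refl p) (≡⇒≈ (*-zeroʳ a)))
    c[c+a] : c * c + a * c ≈ 0
    c[c+a] = trans (≡⇒≈ (sym (*-distribʳ-+ c c a)))
                   (*-cong (trans (≡⇒≈ (+-comm c a)) p) refl)

  ^-period : ∀ {x P} → x ^ P ≈ 1 → ∀ k → x ^ (P * k) ≈ 1
  ^-period {x} {P} xᴾ≈1 k = trans (≡⇒≈ (sym (^-*-assoc x P k)))
                                  (trans (^-cong k xᴾ≈1) (≡⇒≈ (^-zeroˡ k)))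

  ^-period-of-power : ∀ {x P} k → x ^ P ≈ 1 → (x ^ k) ^ P ≈ 1
  ^-period-of-power {x} {P} k xᴾ≈1 =
    trans (≡⇒≈ (trans (^-*-assoc x k P) (cong (x ^_) (*-comm k P)))) (^-period {x} {P} xᴾ≈1 k)

  ^-multiple : ∀ {x t m} → x ^ t ≈ 1 → t ∣ m → x ^ m ≈ 1
  ^-multiple {x} {t} xᵗ≈1 (divides k refl) =
    trans (≡⇒≈ (cong (x ^_) (*-comm k t))) (^-period {x} {t} xᵗ≈1 k)

  ^-%-period : ∀ {x P} .{{_ : NonZero P}} → x ^ P ≈ 1 → ∀ k → x ^ k ≈ x ^ (k % P)
  ^-%-period {x} {P} xᴾ≈1 k = begin
    x ^ k % n                                  ≡⟨ cong (λ e → x ^ e % n) (m≡m%n+[m/n]*n k P) ⟩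
    x ^ (k % P + k / P * P) % n                 ≡⟨ cong (λ e → x ^ (k % P + e) % n) (*-comm (k / P) P) ⟩
    x ^ (k % P + P * (k / P)) % n               ≡⟨ ≡⇒≈ (^-distribˡ-+-* x (k % P) _) ⟩
    (x ^ (k % P) * x ^ (P * (k / P))) % n       ≡⟨ *-cong {x ^ (k % P)} refl (^-period {x} {P} xᴾ≈1 (k / P)) ⟩
    (x ^ (k % P) * 1) % n                       ≡⟨ ≡⇒≈ (*-identityʳ _) ⟩
    x ^ (k % P) % n                             ∎
    where open ≡-Reasoning

  ^-inverse : ∀ {x P} → 0 < P → x ^ P ≈ 1 → ∀ k → x ^ k * x ^ ((P ∸ 1) * k) ≈ 1
  ^-inverse {x} {P} 0<P xᴾ≈1 k = trans (≡⇒≈ (trans (sym (^-distribˡ-+-* x k _)) (cong (x ^_) exponent)))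
                                        (^-period {x} {P} xᴾ≈1 k)
    where
    exponent : k + (P ∸ 1) * k ≡ P * k
    exponent = trans (cong (_+ (P ∸ 1) * k) (sym (*-identityˡ k)))
                     (trans (sym (*-distribʳ-+ k 1 (P ∸ 1))) (cong (_* k) (m+[n∸m]≡n 0<P)))

module Units (n : ℕ) .{{_ : NonZero n}} {x : ℕ} (n⊥x : Coprime n x) where
  open Congruence n

  *-cancelˡ : ∀ {a b} → x * a ≈ x * b → a ≈ b
  *-cancelˡ {a} {b} p with ≤-total b a
  ... | inj₁ b≤a = ∣∸⇒≈ (coprime-divisor n⊥x
        (subst (n ∣_) (sym (*-distribˡ-∸ x a b)) (≈⇒∣∸ p (*-monoʳ-≤ x b≤a)))) b≤a
  ... | inj₂ a≤b = sym (∣∸⇒≈ (coprime-divisor n⊥x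
        (subst (n ∣_) (sym (*-distribˡ-∸ x b a)) (≈⇒∣∸ (sym p) (*-monoʳ-≤ x a≤b)))) a≤b)

  ^-cancelˡ : ∀ {a b} i → x ^ i * a ≈ x ^ i * b → a ≈ b
  ^-cancelˡ {a} {b} zero    p = trans (≡⇒≈ (sym (*-identityˡ a))) (trans p (≡⇒≈ (*-identityˡ b)))
  ^-cancelˡ {a} {b} (suc i) p = ^-cancelˡ i (*-cancelˡ
    (trans (≡⇒≈ (sym (*-assoc x (x ^ i) a))) (trans p (≡⇒≈ (*-assoc x (x ^ i) b)))))

  -- Two of the n + 1 residues x ^ 0, …, x ^ n coincide.
  period : ∃ λ P → 0 < P × x ^ P ≈ 1
  period with pigeonhole (n<1+n n) (λ i → fromℕ< (m%n<n (x ^ toℕ i) n))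
  ... | i , j , i<j , same = toℕ j ∸ toℕ i , m<n⇒0<n∸m i<j , sym (^-cancelˡ (toℕ i) xⁱ≈xʲ)
    where
    xⁱ≈xʲ : x ^ toℕ i * 1 ≈ x ^ toℕ i * x ^ (toℕ j ∸ toℕ i)
    xⁱ≈xʲ = begin
      (x ^ toℕ i * 1) % n                    ≡⟨ cong (_% n) (*-identityʳ _) ⟩
      x ^ toℕ i % n                          ≡⟨ toℕ-fromℕ< _ ⟨
      toℕ (fromℕ< (m%n<n (x ^ toℕ i) n))     ≡⟨ cong toℕ same ⟩
      toℕ (fromℕ< (m%n<n (x ^ toℕ j) n))     ≡⟨ toℕ-fromℕ< _ ⟩
      x ^ toℕ j % n                          ≡⟨ cong (λ e → x ^ e % n) (m+[n∸m]≡n (<⇒≤ i<j)) ⟨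
      x ^ (toℕ i + (toℕ j ∸ toℕ i)) % n      ≡⟨ cong (_% n) (^-distribˡ-+-* x (toℕ i) _) ⟩
      (x ^ toℕ i * x ^ (toℕ j ∸ toℕ i)) % n  ∎
      where open ≡-Reasoning

module _ {P : ℕ → Set} (P? : Decidable P) where

  least-witness : ∀ {m} → P m → ∃ λ k → P k × (∀ j → j < k → ¬ P j)
  least-witness {m} Pm = go m (<-wellFounded m) Pm
    where
    go : ∀ m → Acc _<_ m → P m → ∃ λ k → P k × (∀ j → j < k → ¬ P j)
    go m (acc below) Pm with anyUpTo? P? m
    ... | yes (k , k<m , Pk) = go k (below k<m) Pk
    ... | no none            = m , Pm , λ j j<m Pj → none (j , j<m , Pj)

even⊎odd : ∀ t → Even t ⊎ Odd t
even⊎odd t with t % 2 | m%n<n t 2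
... | 0 | _ = inj₁ refl
... | 1 | _ = inj₂ refl
... | suc (suc _) | s≤s (s≤s ())

even⇒2∣ : ∀ {t} → Even t → 2 ∣ t
even⇒2∣ {t} = m%n≡0⇒n∣m t 2

odd⇒2∤ : ∀ {t} → Odd t → ¬ 2 ∣ t
odd⇒2∤ {t} odd 2∣t with trans (sym (n∣m⇒m%n≡0 t 2 2∣t)) odd
... | ()

odd-divisor : ∀ {m t} → m ∣ t → Odd t → Odd m
odd-divisor {m} m∣t odd with even⊎odd m
... | inj₁ even = ⊥-elim (odd⇒2∤ odd (∣-trans (even⇒2∣ even) m∣t))
... | inj₂ odd′ = odd′

odd⇒coprime-2 : ∀ {t} → Odd t → Coprime t 2
odd⇒coprime-2 odd (d∣t , d∣2) with prime⇒irreducible prime[2] d∣2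
... | inj₁ d≡1 = d≡1
... | inj₂ refl = ⊥-elim (odd⇒2∤ odd d∣t)

1+2l-odd : ∀ l → Odd (1 + l * 2)
1+2l-odd l = [m+kn]%n≡m%n 1 l 2

even≡[/2]*2 : ∀ {t} → Even t → t ≡ t / 2 * 2
even≡[/2]*2 {t} even = trans (m≡m%n+[m/n]*n t 2) (cong (_+ t / 2 * 2) even)

odd≡1+[/2]*2 : ∀ {t} → Odd t → t ≡ 1 + t / 2 * 2
odd≡1+[/2]*2 {t} odd = trans (m≡m%n+[m/n]*n t 2) (cong (_+ t / 2 * 2) odd)

prime-divisor : ∀ {g} → 1 < g → ∃ λ p → Prime p × p ∣ g
prime-divisor {g} 1<g with factorise g {{>-nonZero (<-trans z<s 1<g)}}
... | record { factors = [] ; isFactorisation = g≡1 } = ⊥-elim (<-irrefl (sym g≡1) 1<g)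
... | record { factors = p ∷ ps ; isFactorisation = g≡ ; factorsPrime = prime-p ∷ _ } =
  p , prime-p , divides (product ps) (trans g≡ (*-comm p _))

∣*⇒common-prime : ∀ {n t m} → n ∣ t * m → 0 < t → t < n → ∃ λ r → Prime r × r ∣ n × r ∣ m
∣*⇒common-prime {n} {t} {m} n∣tm 0<t t<n with coprime? n m
... | yes n⊥m =
  ⊥-elim (<⇒≱ t<n (∣⇒≤ {{>-nonZero 0<t}} (coprime-divisor n⊥m (subst (n ∣_) (*-comm t m) n∣tm))))
... | no ¬n⊥m with prime-divisor 1<gcd
  where
  1<gcd : 1 < gcd n m
  1<gcd with gcd n m in g≡ | gcd[m,n]∣m n m
  ... | 0 | 0∣n = ⊥-elim (<⇒≢ (<-trans 0<t t<n) (sym (0∣⇒≡0 0∣n)))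
  ... | 1 | _ = ⊥-elim (¬n⊥m (gcd≡1⇒coprime g≡))
  ... | suc (suc _) | _ = s≤s (s≤s z≤n)
... | r , prime-r , r∣gcd = r , prime-r , ∣-trans r∣gcd (gcd[m,n]∣m n m) , ∣-trans r∣gcd (gcd[m,n]∣n n m)

proper-cofactor : ∀ {n r} .{{_ : NonZero n}} → r ∣ n → 1 < r →
                  ∃ λ s → 1 ≤ s × s < n × (∀ {m} → r ∣ m → n ∣ s * m)
proper-cofactor {n} {r} (divides s n≡sr) 1<r = s , 1≤s , s<n , n∣s*
  where
  s≢0 : s ≢ 0
  s≢0 refl = ≢-nonZero⁻¹ n n≡sr
  1≤s : 1 ≤ s
  1≤s = n≢0⇒n>0 s≢0
  s<n : s < n
  s<n = subst (s <_) (sym n≡sr) (m<m*n s r {{≢-nonZero s≢0}} 1<r)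
  n∣s* : ∀ {m} → r ∣ m → n ∣ s * m
  n∣s* (divides k refl) = divides k (trans (reassoc s k r) (cong (k *_) (sym n≡sr)))
    where
    reassoc : ∀ a b c → a * (b * c) ≡ b * (a * c)
    reassoc = solve-∀

module Order (r : ℕ) .{{_ : NonZero r}} where
  open Congruence r

  ord-exists : ∀ {x P} → 0 < P → x ^ P ≈ 1 → ∃ (IsOrd r x)
  ord-exists {x} {P} 0<P xᴾ≈1 with least-witness positive-period? (0<P , xᴾ≈1)
    where
    positive-period? : Decidable (λ t → 0 < t × x ^ t ≈ 1)
    positive-period? t with 0 <? t | x ^ t % r ≟ 1 % r
    ... | yes 0<t | yes xᵗ≈1 = yes (0<t , xᵗ≈1)
    ... | no ¬0<t | _        = no λ p → ¬0<t (proj₁ p)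
    ... | _       | no xᵗ≉1  = no λ p → xᵗ≉1 (proj₂ p)
  ... | t , (0<t , xᵗ≈1) , smaller = t , 0<t , xᵗ≈1 , λ s 0<s s<t xˢ≈1 → smaller s s<t (0<s , xˢ≈1)

  ord-∣ : ∀ {x t m} → IsOrd r x t → x ^ m ≈ 1 → t ∣ m
  ord-∣ {x} {t} {m} (0<t , xᵗ≈1 , minimal) xᵐ≈1 = m%n≡0⇒n∣m m t m%t≡0
    where
    instance
      t≢0 : NonZero t
      t≢0 = >-nonZero 0<t
    xᵐ≈xᵐ%ᵗ : x ^ m ≈ x ^ (m % t)
    xᵐ≈xᵐ%ᵗ = ^-%-period {x} {t} xᵗ≈1 m
    m%t≡0 : m % t ≡ 0
    m%t≡0 with m % t ≟ 0
    ... | yes m%t≡0 = m%t≡0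
    ... | no m%t≢0 =
      ⊥-elim (minimal (m % t) (n≢0⇒n>0 m%t≢0) (m%n<n m t) (trans (sym xᵐ≈xᵐ%ᵗ) xᵐ≈1))

module PrimeModulus (r : ℕ) (prime-r : Prime r) where
  instance
    r≢0 : NonZero r
    r≢0 = prime⇒nonZero prime-r
  open Congruence r
  open Order r

  1<r : 1 < r
  1<r = nonTrivial⇒n>1 r {{prime⇒nonTrivial prime-r}}

  square≈1 : ∀ a → a * a ≈ 1 → a ≈ 1 ⊎ r ∣ a + 1
  square≈1 zero 0≈1 = ⊥-elim (0≢1+n (trans (sym (m*n%n≡0 0 r)) (trans 0≈1 (m<n⇒m%n≡m 1<r))))
  square≈1 (suc a) a²≈1
    with euclidsLemma a (a + 2) prime-r (subst (r ∣_) (factor a) (≈⇒∣∸ a²≈1 (s≤s z≤n)))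
    where
    factor : ∀ a → a + a * suc a ≡ a * (a + 2)
    factor = solve-∀
  ... | inj₁ r∣a   = inj₁ (∣∸⇒≈ r∣a (s≤s z≤n))
  ... | inj₂ r∣a+2 = inj₂ (subst (r ∣_) (+-suc a 1) r∣a+2)

  even-ord∧odd-ord²⇒∣q^odd+1 : ∀ {q t₁ t₂} → IsOrd r q t₁ → IsOrd r (q ^ 2) t₂ →
                                Even t₁ → Odd t₂ → ∃ λ l → r ∣ q ^ (1 + l * 2) + 1
  even-ord∧odd-ord²⇒∣q^odd+1 {q} {t₁} {t₂}
    ord₁@(0<t₁ , qᵗ¹≈1 , minimal) (_ , q²ᵗ²≈1 , _) even₁ odd₂ =
    u / 2 , subst (λ e → r ∣ q ^ e + 1) (odd≡1+[/2]*2 {u} odd-u) r∣qᵘ+1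
    where
    u : ℕ
    u = t₁ / 2
    t₁≡u*2 : t₁ ≡ u * 2
    t₁≡u*2 = even≡[/2]*2 even₁
    0<u : 0 < u
    0<u = n≢0⇒n>0 λ u≡0 → <-irrefl (sym (trans t₁≡u*2 (cong (_* 2) u≡0))) 0<t₁
    u<t₁ : u < t₁
    u<t₁ = subst (u <_) (sym t₁≡u*2) (m<m*n u 2 {{>-nonZero 0<u}} (s≤s (s≤s z≤n)))
    r∣qᵘ+1 : r ∣ q ^ u + 1
    r∣qᵘ+1 with square≈1 (q ^ u) (trans (≡⇒≈ qᵘqᵘ≡qᵗ¹) qᵗ¹≈1)
      where
      qᵘqᵘ≡qᵗ¹ : q ^ u * q ^ u ≡ q ^ t₁
      qᵘqᵘ≡qᵗ¹ = trans (sym (^-distribˡ-+-* q u u))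
                       (cong (q ^_) (trans (cong (u +_) (sym (+-identityʳ u))) (trans (*-comm 2 u) (sym t₁≡u*2))))
    ... | inj₁ qᵘ≈1   = ⊥-elim (minimal u 0<u u<t₁ qᵘ≈1)
    ... | inj₂ r∣qᵘ+1 = r∣qᵘ+1
    u∣t₂ : u ∣ t₂
    u∣t₂ = *-cancelʳ-∣ 2 (subst₂ _∣_ t₁≡u*2 (*-comm 2 t₂)
             (ord-∣ ord₁ (trans (≡⇒≈ (sym (^-*-assoc q 2 t₂))) q²ᵗ²≈1)))
    odd-u : Odd u
    odd-u = odd-divisor {u} u∣t₂ odd₂

  ∣q^odd+1⇒¬odd-ord⊎even-ord² : ∀ {q t₁ t₂} → r ≢ 2 → ∀ l → r ∣ q ^ (1 + l * 2) + 1 →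
                                 IsOrd r q t₁ → IsOrd r (q ^ 2) t₂ → ¬ (Odd t₁ ⊎ Even t₂)
  ∣q^odd+1⇒¬odd-ord⊎even-ord² {q} {t₁} {t₂} r≢2 l r∣qᵉ+1 ord₁ ord₂ = refute
    where
    e : ℕ
    e = 1 + l * 2
    qᵉ+1≈0 : q ^ e + 1 ≈ 0
    qᵉ+1≈0 = ∣⇒≈0 r∣qᵉ+1
    q²ᵉ≈1 : q ^ (2 * e) ≈ 1
    q²ᵉ≈1 = trans (≡⇒≈ (trans (cong (λ k → q ^ (e + k)) (+-identityʳ e)) (^-distribˡ-+-* q e e)))
                  (sum≈0⇒square≈square qᵉ+1≈0)
    refute : ¬ (Odd t₁ ⊎ Even t₂)
    refute (inj₂ even₂) =
      odd⇒2∤ {e} (1+2l-odd l)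
        (∣-trans (even⇒2∣ even₂) (ord-∣ ord₂ (trans (≡⇒≈ (^-*-assoc q 2 e)) q²ᵉ≈1)))
    refute (inj₁ odd₁) = r≢2 (≤-antisym (∣⇒≤ r∣2) 1<r)
      where
      t₁∣e : t₁ ∣ e
      t₁∣e = coprime-divisor (odd⇒coprime-2 odd₁) (ord-∣ ord₁ q²ᵉ≈1)
      r∣2 : r ∣ 2
      r∣2 = ≈0⇒∣ (trans (+-cong (sym (^-multiple {q} (proj₁ (proj₂ ord₁)) t₁∣e)) (refl {x = 1 % r}))
                        qᵉ+1≈0)

  ords-exist : ∀ {q} → Coprime r q → ∃ (IsOrd r q) × ∃ (IsOrd r (q ^ 2))
  ords-exist {q} r⊥q with Units.period r r⊥q
  ... | P , 0<P , qᴾ≈1 =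
    ord-exists {q} 0<P qᴾ≈1 , ord-exists {q ^ 2} 0<P (^-period-of-power {q} {P} 2 qᴾ≈1)

module Cosets (n q : ℕ) .{{_ : NonZero n}} where
  open Congruence n

  coset-self : ∀ s → InCoset n q s (s % n)
  coset-self s = 0 , cong (_% n) (sym (*-identityʳ s))

  coset-≈ : ∀ {s s′ t} → s ≈ s′ → InCoset n q s t → InCoset n q s′ t
  coset-≈ {s} {s′} s≈s′ (j , t≡) = j , trans t≡ (*-cong {s} {s′} {(q ^ 2) ^ j} s≈s′ refl)

  coset-trans : ∀ {s t u} → InCoset n q s t → InCoset n q t u → InCoset n q s u
  coset-trans {s} {t} {u} (i , refl) (j , refl) = i + j , (begin
    ((s * x ^ i) % n * x ^ j) % n ≡⟨ *-cong {(s * x ^ i) % n} {s * x ^ i} {x ^ j} (%-≈ _) refl ⟩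
    (s * x ^ i * x ^ j) % n       ≡⟨ cong (_% n) (*-assoc s (x ^ i) (x ^ j)) ⟩
    (s * (x ^ i * x ^ j)) % n     ≡⟨ cong (λ y → (s * y) % n) (^-distribˡ-+-* x i j) ⟨
    (s * x ^ (i + j)) % n         ∎)
    where
    open ≡-Reasoning
    x : ℕ
    x = q ^ 2

  unionOfCosets-closed : ∀ {S s t} → UnionOfCosets n q S → InCoset n q s t → S s → S t
  unionOfCosets-closed {S} {s} {t} (_ , _ , S⇔) sᶜt Ss with to (S⇔ s) Ss
  ... | a , Ia , aᶜs = from (S⇔ t) (a , Ia , coset-trans {a} aᶜs sᶜt)

  coset-closed⇒unionOfCosets : ∀ {S} → (∀ s → S s → s < n) →
                               (∀ {s t} → InCoset n q s t → S s → S t) → UnionOfCosets n q S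
  coset-closed⇒unionOfCosets {S} bounded closed = S , bounded , λ t →
    mk⇔ (λ St → t , St , subst (InCoset n q t) (m<n⇒m%n≡m (bounded t St)) (coset-self t))
        (λ (s , Ss , sᶜt) → closed sᶜt Ss)

  splitting⇒¬self-conjugate : ∀ {b s} → GivesSplitting n q b → 1 ≤ s → s < n →
                              ¬ InCoset n q ((b * s) % n) s
  splitting⇒¬self-conjugate {s = s}
    (_ , _ , U₁ , U₂ , cover , disjoint , bS₁≐S₂ , bS₂≐S₁) 1≤s s<n self
    with from (cover s) (1≤s , s<n)
  ... | inj₁ S₁s = disjoint s S₁s (unionOfCosets-closed U₂ self (to (bS₁≐S₂ _) (s , S₁s , refl)))
  ... | inj₂ S₂s = disjoint s (unionOfCosets-closed U₁ self (to (bS₂≐S₁ _) (s , S₂s , refl))) S₂s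

module CosetRepresentatives (n q : ℕ) .{{_ : NonZero n}} (n⊥q : Coprime n q) where
  open Congruence n
  open Cosets n q

  period : ℕ
  period = proj₁ (Units.period n n⊥q)

  0<period : 0 < period
  0<period = proj₁ (proj₂ (Units.period n n⊥q))

  q²-period : (q ^ 2) ^ period ≈ 1
  q²-period = ^-period-of-power {q} {period} 2 (proj₂ (proj₂ (Units.period n n⊥q)))

  q²ʲ-inverse : ∀ j → (q ^ 2) ^ j * (q ^ 2) ^ ((period ∸ 1) * j) ≈ 1
  q²ʲ-inverse = ^-inverse {q ^ 2} 0<period q²-period

  coset-in-range : ∀ {s t} → 1 ≤ s → s < n → InCoset n q s t → 1 ≤ t × t < n
  coset-in-range 1≤s s<n (j , refl) =
    ≉0⇒residue-in-range (≉0-*-unit (in-range⇒≉0 1≤s s<n) (q²ʲ-inverse j))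

  coset-sym : ∀ {s t} → InCoset n q s t → InCoset n q t (s % n)
  coset-sym {s} (j , refl) = (period ∸ 1) * j , sym (begin
    ((s * x ^ j) % n * x ^ k) % n ≡⟨ *-cong {(s * x ^ j) % n} {s * x ^ j} {x ^ k} (%-≈ _) refl ⟩
    (s * x ^ j * x ^ k) % n       ≡⟨ cong (_% n) (*-assoc s (x ^ j) (x ^ k)) ⟩
    (s * (x ^ j * x ^ k)) % n     ≡⟨ *-cong {s} refl (q²ʲ-inverse j) ⟩
    (s * 1) % n                   ≡⟨ cong (_% n) (*-identityʳ s) ⟩
    s % n                         ∎)
    where
    open ≡-Reasoning
    x k : ℕ
    x = q ^ 2
    k = (period ∸ 1) * j

  common-element⇒coset : ∀ {a c u} → InCoset n q a u → InCoset n q c u → InCoset n q a (c % n)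
  common-element⇒coset {a} aᶜu cᶜu = coset-trans {a} aᶜu (coset-sym cᶜu)

  coset? : ∀ s t → Dec (InCoset n q s t)
  coset? s t with anyUpTo? (λ j → t ≟ (s * (q ^ 2) ^ j) % n) period
  ... | yes (j , _ , t≡) = yes (j , t≡)
  ... | no none = no λ (j , t≡) → none (j % period , m%n<n j period ,
          trans t≡ (*-cong {s} refl (^-%-period {q ^ 2} {period} q²-period j)))
    where
    instance
      period≢0 : NonZero period
      period≢0 = >-nonZero 0<period

  least : ℕ → ℕ
  least s = proj₁ (least-witness (coset? s) (coset-self s))

  least-∈ : ∀ s → InCoset n q s (least s)
  least-∈ s = proj₁ (proj₂ (least-witness (coset? s) (coset-self s)))

  least-≤ : ∀ {s u} → InCoset n q s u → least s ≤ u
  least-≤ {s} {u} sᶜu =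
    ≮⇒≥ λ u<least → proj₂ (proj₂ (least-witness (coset? s) (coset-self s))) u u<least sᶜu

  least-coset : ∀ {s t} → InCoset n q s t → least t ≡ least s
  least-coset {s} {t} sᶜt = ≤-antisym
    (least-≤ (coset-trans {t} (coset-sym sᶜt) (coset-≈ {s} (sym (%-≈ s)) (least-∈ s))))
    (least-≤ (coset-trans {s} sᶜt (least-∈ t)))

module SplittingByMultiplier (n q b : ℕ) .{{_ : NonZero n}} (n⊥q : Coprime n q)
                             (b²≈q² : Congruence._≈_ n (b * b) (q ^ 2)) where
  open Congruence n
  open Cosets n q
  open CosetRepresentatives n q n⊥q

  μ : ℕ → ℕ
  μ t = (b * t) % n

  b⁻¹ : ℕ
  b⁻¹ = b * (q ^ 2) ^ (period ∸ 1)

  b*b⁻¹≈1 : b * b⁻¹ ≈ 1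
  b*b⁻¹≈1 = begin
    (b * (b * x ^ (period ∸ 1))) % n     ≡⟨ ≡⇒≈ (sym (*-assoc b b _)) ⟩
    (b * b * x ^ (period ∸ 1)) % n       ≡⟨ *-cong {b * b} {x} {x ^ (period ∸ 1)} b²≈q² refl ⟩
    (x * x ^ (period ∸ 1)) % n           ≡⟨ cong₂ (λ y e → (y * x ^ e) % n)
                                                  (sym (*-identityʳ x)) (sym (*-identityʳ (period ∸ 1))) ⟩
    (x ^ 1 * x ^ ((period ∸ 1) * 1)) % n ≡⟨ q²ʲ-inverse 1 ⟩
    1 % n                                ∎
    where
    open ≡-Reasoning
    x : ℕ
    x = q ^ 2

  μ-in-range : ∀ {s} → 1 ≤ s → s < n → 1 ≤ μ s × μ s < n
  μ-in-range {s} 1≤s s<n = ≉0⇒residue-in-range λ bs≈0 →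
    ≉0-*-unit (in-range⇒≉0 1≤s s<n) b*b⁻¹≈1 (trans (≡⇒≈ (*-comm s b)) bs≈0)

  μ-surjective : ∀ {t} → 1 ≤ t → t < n → ∃ λ s → (1 ≤ s × s < n) × μ s ≡ t
  μ-surjective {t} 1≤t t<n = s , s-in-range , trans (sym (%-≈ (b * s))) (trans μs≈t (m<n⇒m%n≡m t<n))
    where
    s : ℕ
    s = (b⁻¹ * t) % n
    s-in-range : 1 ≤ s × s < n
    s-in-range = ≉0⇒residue-in-range λ b⁻¹t≈0 →
      ≉0-*-unit (in-range⇒≉0 1≤t t<n) (trans (≡⇒≈ (*-comm b⁻¹ b)) b*b⁻¹≈1)
                (trans (≡⇒≈ (*-comm t b⁻¹)) b⁻¹t≈0)
    μs≈t : μ s ≈ t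
    μs≈t = begin
      μ s % n             ≡⟨ %-≈ (b * s) ⟩
      (b * s) % n         ≡⟨ *-cong {b} refl (%-≈ (b⁻¹ * t)) ⟩
      (b * (b⁻¹ * t)) % n ≡⟨ ≡⇒≈ (sym (*-assoc b b⁻¹ t)) ⟩
      (b * b⁻¹ * t) % n   ≡⟨ *-cong {b * b⁻¹} {1} {t} b*b⁻¹≈1 refl ⟩
      (1 * t) % n         ≡⟨ cong (_% n) (*-identityˡ t) ⟩
      t % n               ∎
      where open ≡-Reasoning

  μ-coset : ∀ {s t} → InCoset n q s t → InCoset n q (μ s) (μ t)
  μ-coset {s} (j , refl) = j , (begin
    (b * ((s * x ^ j) % n)) % n ≡⟨ *-cong {b} refl (%-≈ _) ⟩
    (b * (s * x ^ j)) % n       ≡⟨ ≡⇒≈ (sym (*-assoc b s (x ^ j))) ⟩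
    (b * s * x ^ j) % n         ≡⟨ *-cong {b * s} {(b * s) % n} {x ^ j} (sym (%-≈ (b * s))) refl ⟩
    ((b * s) % n * x ^ j) % n   ∎)
    where
    open ≡-Reasoning
    x : ℕ
    x = q ^ 2

  μ-μ-coset : ∀ s → InCoset n q s (μ (μ s))
  μ-μ-coset s = 1 , (begin
    (b * ((b * s) % n)) % n ≡⟨ *-cong {b} refl (%-≈ (b * s)) ⟩
    (b * (b * s)) % n       ≡⟨ ≡⇒≈ (sym (*-assoc b b s)) ⟩
    (b * b * s) % n         ≡⟨ *-cong {b * b} {q ^ 2} {s} b²≈q² refl ⟩
    (q ^ 2 * s) % n         ≡⟨ cong (_% n) (*-comm (q ^ 2) s) ⟩
    (s * q ^ 2) % n         ≡⟨ cong (λ y → (s * y) % n) (*-identityʳ (q ^ 2)) ⟨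
    (s * (q ^ 2) ^ 1) % n   ∎)
    where open ≡-Reasoning

  S₁ S₂ : Subset
  S₁ t = (1 ≤ t × t < n) × least t < least (μ t)
  S₂ t = (1 ≤ t × t < n) × least (μ t) < least t

  S₁-closed : ∀ {s t} → InCoset n q s t → S₁ s → S₁ t
  S₁-closed sᶜt ((1≤s , s<n) , lt) =
    coset-in-range 1≤s s<n sᶜt , subst₂ _<_ (sym (least-coset sᶜt)) (sym (least-coset (μ-coset sᶜt))) lt

  S₂-closed : ∀ {s t} → InCoset n q s t → S₂ s → S₂ t
  S₂-closed sᶜt ((1≤s , s<n) , lt) =
    coset-in-range 1≤s s<n sᶜt , subst₂ _<_ (sym (least-coset (μ-coset sᶜt))) (sym (least-coset sᶜt)) lt

  S₁⇔S₂∘μ : ∀ {s} → 1 ≤ s → s < n → S₁ s ⇔ S₂ (μ s)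
  S₁⇔S₂∘μ {s} 1≤s s<n = mk⇔
    (λ (_ , lt) → μ-in-range 1≤s s<n , subst (_< least (μ s)) (sym (least-coset (μ-μ-coset s))) lt)
    (λ (_ , lt) → (1≤s , s<n) , subst (_< least (μ s)) (least-coset (μ-μ-coset s)) lt)

  S₂⇔S₁∘μ : ∀ {s} → 1 ≤ s → s < n → S₂ s ⇔ S₁ (μ s)
  S₂⇔S₁∘μ {s} 1≤s s<n = mk⇔
    (λ (_ , lt) → μ-in-range 1≤s s<n , subst (least (μ s) <_) (sym (least-coset (μ-μ-coset s))) lt)
    (λ (_ , lt) → (1≤s , s<n) , subst (least (μ s) <_) (least-coset (μ-μ-coset s)) lt)

  μ-image : ∀ {S S′ : Subset} → (∀ {t} → S′ t → 1 ≤ t × t < n) →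
            (∀ {s} → 1 ≤ s → s < n → S s ⇔ S′ (μ s)) → (∀ {s} → S s → 1 ≤ s × s < n) →
            (b · S mod n) ≐ S′
  μ-image {S} {S′} S′-in-range S⇔S′∘μ S-in-range t = mk⇔
    (λ { (s , Ss , refl) → to (S⇔S′∘μ (proj₁ (S-in-range Ss)) (proj₂ (S-in-range Ss))) Ss })
    λ S′t → let (s , (1≤s , s<n) , μs≡t) = μ-surjective (proj₁ (S′-in-range S′t)) (proj₂ (S′-in-range S′t))
            in s , from (S⇔S′∘μ 1≤s s<n) (subst S′ (sym μs≡t) S′t) , sym μs≡t

  equal-least⇒self-conjugate : ∀ {t} → t < n → least t ≡ least (μ t) → InCoset n q (μ t) t
  equal-least⇒self-conjugate {t} t<n same = subst (InCoset n q (μ t)) (m<n⇒m%n≡m t<n)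
    (common-element⇒coset {μ t} (least-∈ (μ t)) (subst (InCoset n q t) same (least-∈ t)))

  splitting : (∀ {t} → 1 ≤ t → t < n → ¬ InCoset n q (μ t) t) → GivesSplitting n q b
  splitting ¬self-conjugate =
    S₁ , S₂ , coset-closed⇒unionOfCosets (λ _ → proj₂ ∘ proj₁) S₁-closed ,
    coset-closed⇒unionOfCosets (λ _ → proj₂ ∘ proj₁) S₂-closed ,
    (λ t → mk⇔ [ proj₁ , proj₁ ] (in-range⇒S₁⊎S₂ t)) , (λ t (_ , lt) (_ , gt) → <-asym lt gt) ,
    μ-image proj₁ S₁⇔S₂∘μ proj₁ , μ-image proj₁ S₂⇔S₁∘μ proj₁
    where
    in-range⇒S₁⊎S₂ : ∀ t → 1 ≤ t × t < n → S₁ t ⊎ S₂ t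
    in-range⇒S₁⊎S₂ t (1≤t , t<n) with <-cmp (least t) (least (μ t))
    ... | tri< lt _ _ = inj₁ ((1≤t , t<n) , lt)
    ... | tri≈ _ same _ = ⊥-elim (¬self-conjugate 1≤t t<n (equal-least⇒self-conjugate t<n same))
    ... | tri> _ _ gt = inj₂ ((1≤t , t<n) , gt)

module NegativeMultiplier (n q : ℕ) .{{_ : NonZero n}} where
  open Congruence n

  negMod+q≈0 : negMod n q + q ≈ 0
  negMod+q≈0 = begin
    (negMod n q + q) % n        ≡⟨ +-cong {negMod n q} {(n ∸ 1) * q} {q} (%-≈ _) refl ⟩
    ((n ∸ 1) * q + q) % n       ≡⟨ cong (_% n) (trans (+-comm _ q) (+-negate q)) ⟩
    (q * n) % n                 ≡⟨ ∣⇒≈0 (n∣m*n q) ⟩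
    0 % n                       ∎
    where open ≡-Reasoning

  negMod²≈q² : negMod n q * negMod n q ≈ q ^ 2
  negMod²≈q² = trans (sum≈0⇒square≈square {negMod n q} {q} negMod+q≈0)
                     (cong (λ y → (q * y) % n) (sym (*-identityʳ q)))

  self-conjugate⇔∣ : ∀ {t} → t < n →
                     InCoset n q ((negMod n q * t) % n) t ⇔ ∃ λ l → n ∣ t * (q ^ (1 + l * 2) + 1)
  self-conjugate⇔∣ {t} t<n = mk⇔
    (λ (l , t≡) → l , to (congruence⇔∣ l) (trans (cong (_% n) t≡) (trans (%-≈ _) (residue l))))
    (λ (l , n∣) → l , trans (sym (m<n⇒m%n≡m t<n)) (trans (from (congruence⇔∣ l) n∣) (sym (residue l))))
    where
    b : ℕ
    b = negMod n q
    residue : ∀ l → (b * t) % n * (q ^ 2) ^ l ≈ b * t * (q ^ 2) ^ l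
    residue l = *-cong {(b * t) % n} {b * t} {(q ^ 2) ^ l} (%-≈ (b * t)) refl
    expand : ∀ l → t * (q ^ (1 + l * 2) + 1) ≡ q * (t * (q ^ 2) ^ l) + t
    expand l = begin
      t * (q ^ (1 + l * 2) + 1)     ≡⟨ cong (λ e → t * (q * q ^ e + 1)) (*-comm l 2) ⟩
      t * (q * q ^ (2 * l) + 1)     ≡⟨ cong (λ y → t * (q * y + 1)) (^-*-assoc q 2 l) ⟨
      t * (q * (q ^ 2) ^ l + 1)     ≡⟨ distribute t q ((q ^ 2) ^ l) ⟩
      q * (t * (q ^ 2) ^ l) + t     ∎
      where
      open ≡-Reasoning
      distribute : ∀ t q y → t * (q * y + 1) ≡ q * (t * y) + t
      distribute = solve-∀
    conjugate+q≈0 : ∀ l → b * t * (q ^ 2) ^ l + q * (t * (q ^ 2) ^ l) ≈ 0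
    conjugate+q≈0 l = trans (≡⇒≈ (factor b q t ((q ^ 2) ^ l)))
                            (*-cong {b + q} {0} {t * (q ^ 2) ^ l} negMod+q≈0 refl)
      where
      factor : ∀ b q t y → b * t * y + q * (t * y) ≡ (b + q) * (t * y)
      factor = solve-∀
    congruence⇔∣ : ∀ l → t ≈ b * t * (q ^ 2) ^ l ⇔ n ∣ t * (q ^ (1 + l * 2) + 1)
    congruence⇔∣ l = mk⇔
      (λ t≈ → ≈0⇒∣ (trans (≡⇒≈ (trans (expand l) (+-comm _ t)))
                         (trans (+-cong t≈ refl) (conjugate+q≈0 l))))
      (λ n∣ → sum≈0-unique (trans (≡⇒≈ (trans (+-comm t _) (sym (expand l)))) (∣⇒≈0 n∣))
                           (conjugate+q≈0 l))

OrdCondition : ℕ → ℕ → Set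
OrdCondition n q = (r : ℕ) (pr : Prime r) → r ∣ n → (t₁ t₂ : ℕ) →
  IsOrd r {{prime⇒nonZero pr}} q t₁ → IsOrd r {{prime⇒nonZero pr}} (q ^ 2) t₂ → Odd t₁ ⊎ Even t₂

splitting⇒ordCondition : ∀ n q .{{_ : NonZero n}} → GivesSplitting n q (negMod n q) → OrdCondition n q
splitting⇒ordCondition n q split r prime-r r∣n t₁ t₂ ord₁ ord₂ with even⊎odd t₁ | even⊎odd t₂
... | inj₂ odd₁  | _          = inj₁ odd₁
... | inj₁ _     | inj₁ even₂ = inj₂ even₂
... | inj₁ even₁ | inj₂ odd₂
  with PrimeModulus.even-ord∧odd-ord²⇒∣q^odd+1 r prime-r ord₁ ord₂ even₁ odd₂
     | proper-cofactor r∣n (PrimeModulus.1<r r prime-r)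
... | l , r∣qᵉ+1 | s , 1≤s , s<n , n∣s* =
  ⊥-elim (Cosets.splitting⇒¬self-conjugate n q {negMod n q} split 1≤s s<n
    (from (NegativeMultiplier.self-conjugate⇔∣ n q s<n) (l , n∣s* r∣qᵉ+1)))

ordCondition⇒splitting : ∀ n q .{{_ : NonZero n}} → Odd n → Coprime n q → OrdCondition n q →
                         GivesSplitting n q (negMod n q)
ordCondition⇒splitting n q odd-n n⊥q condition =
  SplittingByMultiplier.splitting n q (negMod n q) n⊥q negMod²≈q² ¬self-conjugate
  where
  open NegativeMultiplier n q
  ¬self-conjugate : ∀ {t} → 1 ≤ t → t < n → ¬ InCoset n q ((negMod n q * t) % n) t
  ¬self-conjugate 1≤t t<n self with to (self-conjugate⇔∣ t<n) self
  ... | l , n∣ with ∣*⇒common-prime n∣ 1≤t t<n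
  ... | r , prime-r , r∣n , r∣qᵉ+1
    with PrimeModulus.ords-exist r prime-r (λ (d∣r , d∣q) → n⊥q (∣-trans d∣r r∣n , d∣q))
  ... | (t₁ , ord₁) , (t₂ , ord₂) =
    PrimeModulus.∣q^odd+1⇒¬odd-ord⊎even-ord² r prime-r r≢2 l r∣qᵉ+1 ord₁ ord₂
      (condition r prime-r r∣n t₁ t₂ ord₁ ord₂)
    where
    r≢2 : r ≢ 2
    r≢2 refl = odd⇒2∤ {n} odd-n r∣n

theorem5p7 : (q n : ℕ) .{{_ : NonZero n}} → IsPrimePower q → n % 2 ≡ 1 → Coprime n q →
    GivesSplitting n q (negMod n q) ⇔
      ((r : ℕ) (pr : Prime r) → r ∣ n → (t₁ t₂ : ℕ) →
        IsOrd r {{prime⇒nonZero pr}} q t₁ → IsOrd r {{prime⇒nonZero pr}} (q ^ 2) t₂ →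
        Odd t₁ ⊎ Even t₂)
theorem5p7 q n _ odd-n n⊥q = mk⇔ (splitting⇒ordCondition n q) (ordCondition⇒splitting n q odd-n n⊥q)
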